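{- For every integer $r\ge 1$, $$|B_x(2,r)|=\frac{2r^{3}+15r^{2}+58r+22.5+1.5(-1)^{r}}{24}.$$
   Context: Let $I$ (left vertices) and $O$ (right vertices) be disjoint finite sets with $|I|=n$ and $|O|=r$. An $(n,r)$-bipartite graph is $G=(I\oplus O,E)$ with edge set $E\subseteq I\times O$. The connected domain $I_c(G)$ is the set of vertices of $I$ with nonzero degree in $G$. Two $(n,r)$-bipartite graphs $G_1=(I\oplus O,E_1)$ and $G_2=(I\oplus O,E_2)$ are left-set-labeled equivalent if there exist bijections $\alpha:I\to I$ and $\beta:O\to O$ such that for all $x\in I,y\in O$, $(x,y)\in E_1$ iff $(\alpha(x),\beta(y))\in E_2$, and moreover $I_c(G_1)=I_c(G_2)$. $B_x(n,r)$ denotes the set of equivalence classes of $(n,r)$-bipartite graphs under left-set-labeled equivalence (the left-set-labeled $(n,r)$-bipartite graphs). -}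

module Defs where

open import Data.Nat using (ℕ)
open import Data.Bool using (Bool; true)
open import Data.Fin using (Fin)
open import Data.Fin.Permutation using (Permutation′; _⟨$⟩ʳ_)
open import Data.Product using (Σ; ∃; _×_)
open import Data.List using (List; length)
open import Data.List.Relation.Unary.Any using (Any)
open import Data.List.Relation.Unary.AllPairs using (AllPairs)
open import Relation.Binary.PropositionalEquality using (_≡_)
open import Relation.Nullary using (¬_)
open import Function.Bundles using (_⇔_)

BipGraph : ℕ → ℕ → Set
BipGraph n r = Fin n → Fin r → Bool

InConnDomain : ∀ {n r} → BipGraph n r → Fin n → Set
InConnDomain G x = ∃ λ y → G x y ≡ true

LSLEquiv : ∀ {n r} → BipGraph n r → BipGraph n r → Set
LSLEquiv {n} {r} G₁ G₂ =
  (Σ (Permutation′ n) λ α → Σ (Permutation′ r) λ β →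
     ∀ x y → G₁ x y ≡ G₂ (α ⟨$⟩ʳ x) (β ⟨$⟩ʳ y))
  × (∀ x → InConnDomain G₁ x ⇔ InConnDomain G₂ x)

-- |B_x(n,r)| = N : there is a complete list of pairwise inequivalent
-- representatives of the equivalence classes, of length N.
NumClassesIs : ℕ → ℕ → ℕ → Set
NumClassesIs n r N =
  Σ (List (BipGraph n r)) λ L →
    (length L ≡ N)
    × (∀ G → Any (LSLEquiv G) L)
    × AllPairs (λ G H → ¬ LSLEquiv G H) L

-- A graph in B(2, r) is determined, up to relabelling the right vertices, by its profile: how many
-- right vertices are adjacent to neither, both, only the first or only the second left vertex.
-- Relabelling the left vertices either fixes the profile or exchanges the last two numbers, and the
-- condition on I_c allows the exchange exactly when both or neither left vertex is isolated. So the
-- classes are represented by the profiles (a, d, b, c) with b ≤ c together with the profiles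
-- (a, 0, b, 0) with b > 0, and summing over a, then d, then b ≤ c gives the cubic count.

module Submission where

open import Defs
open import Data.Nat using (ℕ; zero; suc; _≤_)
open import Data.Bool using (Bool; true; false; if_then_else_)
open import Data.Bool.Properties using () renaming (_≟_ to _≟ᵇ_)
open import Data.Fin using (Fin; zero; suc)
open import Data.Fin.Permutation
  using ( Permutation′; _⟨$⟩ʳ_; _⟨$⟩ˡ_; _≈_; id; reverse; inverseˡ; inverseʳ
        ; remove; insert; punchIn-permute; insert-punchIn )
open import Data.Vec.Functional using (Vector; head; tail; removeAt) renaming (_∷_ to _∷ᵥ_)
open import Data.Sum using (_⊎_; inj₁; inj₂)
open import Data.Product using (Σ; ∃; _×_; _,_; _,′_; proj₁; proj₂; swap; map₁)
import Data.Product as Product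
open import Data.Product.Properties using (≡-dec)
open import Data.List using (List; []; _∷_; _++_; map; length)
open import Data.List.Properties using (length-++; length-map; map-∘; map-id-local)
open import Data.List.Membership.Propositional using (_∈_)
open import Data.List.Membership.Propositional.Properties
  using (∈-map⁺; ∈-map⁻; ∈-++⁺ˡ; ∈-++⁺ʳ; ∈-++⁻)
open import Data.List.Relation.Unary.Any using (Any; here; there)
import Data.List.Relation.Unary.Any as Any
import Data.List.Relation.Unary.Any.Properties as Any
import Data.List.Relation.Unary.All as All
open import Data.List.Relation.Unary.AllPairs using (AllPairs; []; _∷_)
import Data.List.Relation.Unary.AllPairs as AllPairs
import Data.List.Relation.Unary.AllPairs.Properties as AllPairs
open import Data.List.Relation.Unary.Unique.Propositional using (Unique)
import Data.List.Relation.Unary.Unique.Propositional.Properties as Unique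
open import Data.List.Relation.Binary.Disjoint.Propositional using (Disjoint)
open import Function using (_∘_)
open import Function.Bundles using (_⇔_; mk⇔; Equivalence)
open Equivalence using (to; from)
open import Function.Construct.Symmetry using (⇔-sym)
open import Function.Construct.Composition using (_⇔-∘_)
open import Relation.Binary.Definitions using (DecidableEquality)
open import Relation.Unary using (Decidable)
open import Relation.Binary.PropositionalEquality
open import Relation.Nullary using (¬_; does; yes; no; contradiction; _⊎-dec_; _×-dec_)

module Classification where

  open import Data.Nat using (pred; _+_; _<_; z≤n; s≤s; _≤?_; _≟_)
  open import Data.Nat.Properties
    using ( suc-injective; +-suc; +-identityʳ; +-comm; +-cancelˡ-≡; +-commutativeSemigroup
          ; ≤-trans; ≤-antisym; ≰⇒≥; ≰⇒>; m≤m+n )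
  open import Algebra.Properties.CommutativeSemigroup +-commutativeSemigroup using (x∙yz≈y∙xz)

  module Counting {a} {A : Set a} (_≟_ : DecidableEquality A) where

    δ : A → A → ℕ
    δ x t = if does (x ≟ t) then 1 else 0

    count : ∀ {n} → A → Vector A n → ℕ
    count {zero}  t f = 0
    count {suc n} t f = δ (head f) t + count t (tail f)

    δ-refl : ∀ t → δ t t ≡ 1
    δ-refl t with t ≟ t
    ... | yes _  = refl
    ... | no t≢t = contradiction refl t≢t

    count-cong : ∀ {n} t {f g : Vector A n} → (∀ y → f y ≡ g y) → count t f ≡ count t g
    count-cong {zero}  t f≗g = refl
    count-cong {suc n} t f≗g = cong₂ _+_ (cong (λ x → δ x t) (f≗g zero)) (count-cong t (f≗g ∘ suc))

    count-removeAt : ∀ {n} t (f : Vector A (suc n)) i →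
                     count t f ≡ δ (f i) t + count t (removeAt f i)
    count-removeAt t f zero = refl
    count-removeAt {suc n} t f (suc i) = begin
      δ (f zero) t + count t (tail f)
        ≡⟨ cong (δ (f zero) t +_) (count-removeAt t (tail f) i) ⟩
      δ (f zero) t + (δ (f (suc i)) t + count t (removeAt (tail f) i))
        ≡⟨ x∙yz≈y∙xz (δ (f zero) t) (δ (f (suc i)) t) _ ⟩
      δ (f (suc i)) t + (δ (f zero) t + count t (removeAt (tail f) i))
        ∎
      where open ≡-Reasoning

    count-∘-permutation : ∀ {n} t (f : Vector A n) (π : Permutation′ n) →
                          count t (f ∘ (π ⟨$⟩ʳ_)) ≡ count t f
    count-∘-permutation {zero}  t f π = refl
    count-∘-permutation {suc n} t f π = begin
      δ (f (π ⟨$⟩ʳ zero)) t + count t (f ∘ (π ⟨$⟩ʳ_) ∘ suc)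
        ≡⟨ cong (δ (f (π ⟨$⟩ʳ zero)) t +_) (count-cong t (cong f ∘ punchIn-permute π zero)) ⟩
      δ (f (π ⟨$⟩ʳ zero)) t + count t (f′ ∘ (remove zero π ⟨$⟩ʳ_))
        ≡⟨ cong (δ (f (π ⟨$⟩ʳ zero)) t +_) (count-∘-permutation t f′ (remove zero π)) ⟩
      δ (f (π ⟨$⟩ʳ zero)) t + count t f′
        ≡⟨ count-removeAt t f (π ⟨$⟩ʳ zero) ⟨
      count t f
        ∎
      where
      open ≡-Reasoning
      f′ = removeAt f (π ⟨$⟩ʳ zero)

    count-∘-injective : ∀ {n} (h : A → A) → (∀ {x y} → h x ≡ h y → x ≡ y) →
                        ∀ t (f : Vector A n) → count (h t) (h ∘ f) ≡ count t f
    count-∘-injective {zero}  h inj t f = refl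
    count-∘-injective {suc n} h inj t f =
      cong₂ _+_ (δ-injective (head f)) (count-∘-injective h inj t (tail f))
      where
      δ-injective : ∀ x → δ (h x) (h t) ≡ δ x t
      δ-injective x with h x ≟ h t | x ≟ t
      ... | yes _     | yes _   = refl
      ... | no _      | no _    = refl
      ... | yes hx≡ht | no x≢t  = contradiction (inj hx≡ht) x≢t
      ... | no hx≢ht  | yes x≡t = contradiction (cong h x≡t) hx≢ht

    0<count⇔∃ : ∀ {n} t (f : Vector A n) → 0 < count t f ⇔ ∃ λ y → f y ≡ t
    0<count⇔∃ t f = mk⇔ (witness t f) (λ (y , fy≡t) → positive t f y fy≡t)
      where
      witness : ∀ {n} t (f : Vector A n) → 0 < count t f → ∃ λ y → f y ≡ t
      witness {suc n} t f 0<count with head f ≟ t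
      ... | yes f0≡t = zero , f0≡t
      ... | no _     = let (y , fy≡t) = witness t (tail f) 0<count in suc y , fy≡t
      positive : ∀ {n} t (f : Vector A n) y → f y ≡ t → 0 < count t f
      positive {suc n} t f y refl rewrite count-removeAt t f y | δ-refl (f y) = s≤s z≤n

    sameCounts⇔rearrangement : ∀ {n} (f g : Vector A n) →
      (∀ t → count t f ≡ count t g) ⇔ Σ (Permutation′ n) λ π → ∀ y → f y ≡ g (π ⟨$⟩ʳ y)
    sameCounts⇔rearrangement f g = mk⇔ (rearrangement f g)
      (λ (π , f≗g∘π) t → trans (count-cong t f≗g∘π) (count-∘-permutation t g π))
      where
      rearrangement : ∀ {n} (f g : Vector A n) → (∀ t → count t f ≡ count t g) →
                      Σ (Permutation′ n) λ π → ∀ y → f y ≡ g (π ⟨$⟩ʳ y)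
      rearrangement {zero}  f g same = id , λ ()
      rearrangement {suc n} f g same
        with to (0<count⇔∃ (head f) g)
                (subst (0 <_) (same (head f)) (from (0<count⇔∃ (head f) f) (zero , refl)))
      ... | y₀ , gy₀≡f₀ = insert zero y₀ π , matches
        where
        g′ = removeAt g y₀
        same′ : ∀ t → count t (tail f) ≡ count t g′
        same′ t = +-cancelˡ-≡ (δ (head f) t) _ _
          (trans (same t) (trans (count-removeAt t g y₀) (cong (λ x → δ x t + count t g′) gy₀≡f₀)))
        rest = rearrangement (tail f) g′ same′
        π = proj₁ rest
        matches : ∀ y → f y ≡ g (insert zero y₀ π ⟨$⟩ʳ y)
        matches zero    = sym gy₀≡f₀
        matches (suc y) = trans (proj₂ rest y) (cong g (sym (insert-punchIn zero y₀ π y)))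

  Column : Set
  Column = Bool × Bool

  _≟ᶜ_ : DecidableEquality Column
  _≟ᶜ_ = ≡-dec _≟ᵇ_ _≟ᵇ_

  open Counting _≟ᶜ_
  open Counting _≟ᵇ_ using () renaming (δ to δᵇ; count to countᵇ; 0<count⇔∃ to 0<countᵇ⇔∃)

  -- Numbers of columns adjacent to (neither, both, only the first, only the second) left vertex;
  -- the first two come first so that the enumeration below can peel them off.
  Profile : Set
  Profile = ℕ × ℕ × ℕ × ℕ

  profile : ∀ {n} → Vector Column n → Profile
  profile f = count (false , false) f , count (true , true) f , count (true , false) f , count (false , true) f

  multiplicity : Profile → Column → ℕ
  multiplicity (a , d , b , c) (false , false) = a
  multiplicity (a , d , b , c) (true  , true)  = d
  multiplicity (a , d , b , c) (true  , false) = b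
  multiplicity (a , d , b , c) (false , true)  = c

  total : Profile → ℕ
  total (a , d , b , c) = a + (d + (b + c))

  add : Column → Profile → Profile
  add (false , false) (a , d , b , c) = suc a , d , b , c
  add (true  , true)  (a , d , b , c) = a , suc d , b , c
  add (true  , false) (a , d , b , c) = a , d , suc b , c
  add (false , true)  (a , d , b , c) = a , d , b , suc c

  swapᴾ : Profile → Profile
  swapᴾ (a , d , b , c) = a , d , c , b

  profile≡⇔rearrangement : ∀ {n} (f g : Vector Column n) →
    profile f ≡ profile g ⇔ Σ (Permutation′ n) λ β → ∀ y → f y ≡ g (β ⟨$⟩ʳ y)
  profile≡⇔rearrangement f g = sameCounts⇔rearrangement f g ⇔-∘ mk⇔ sameCounts profile≡
    where
    sameCounts : profile f ≡ profile g → ∀ t → count t f ≡ count t g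
    sameCounts eq (false , false) = cong (λ p → multiplicity p (false , false)) eq
    sameCounts eq (true  , true)  = cong (λ p → multiplicity p (true , true)) eq
    sameCounts eq (true  , false) = cong (λ p → multiplicity p (true , false)) eq
    sameCounts eq (false , true)  = cong (λ p → multiplicity p (false , true)) eq
    profile≡ : (∀ t → count t f ≡ count t g) → profile f ≡ profile g
    profile≡ same = cong₂ _,_ (same _) (cong₂ _,_ (same _) (cong₂ _,_ (same _) (same _)))

  profile-∷ : ∀ {n} t (f : Vector Column n) → profile (t ∷ᵥ f) ≡ add t (profile f)
  profile-∷ (false , false) f = refl
  profile-∷ (true  , true)  f = refl
  profile-∷ (true  , false) f = refl
  profile-∷ (false , true)  f = refl

  profile-swap : ∀ {n} (f : Vector Column n) → profile (swap ∘ f) ≡ swapᴾ (profile f)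
  profile-swap f = cong₂ _,_ (swap-count _) (cong₂ _,_ (swap-count _) (cong₂ _,_ (swap-count _) (swap-count _)))
    where
    swap-count : ∀ t → count (swap t) (swap ∘ f) ≡ count t f
    swap-count t = count-∘-injective swap (cong swap) t f

  total-add : ∀ t p → total (add t p) ≡ suc (total p)
  total-add (false , false) (a , d , b , c) = refl
  total-add (true  , true)  (a , d , b , c) = +-suc a (d + (b + c))
  total-add (true  , false) (a , d , b , c) = trans (cong (a +_) (+-suc d (b + c))) (+-suc a _)
  total-add (false , true)  (a , d , b , c) =
    trans (cong (λ k → a + (d + k)) (+-suc b c)) (trans (cong (a +_) (+-suc d (b + c))) (+-suc a _))

  total-profile : ∀ {n} (f : Vector Column n) → total (profile f) ≡ n
  total-profile {zero}  f = refl
  total-profile {suc n} f = begin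
    total (profile f)                         ≡⟨ cong total (profile-∷ (head f) (tail f)) ⟩
    total (add (head f) (profile (tail f)))   ≡⟨ total-add (head f) _ ⟩
    suc (total (profile (tail f)))            ≡⟨ cong suc (total-profile (tail f)) ⟩
    suc n                                     ∎
    where open ≡-Reasoning

  realise : (n : ℕ) → Profile → Vector Column n
  realise zero    p                   = λ ()
  realise (suc n) (suc a , d , b , c) = (false , false) ∷ᵥ realise n (a , d , b , c)
  realise (suc n) (0 , suc d , b , c) = (true , true)   ∷ᵥ realise n (0 , d , b , c)
  realise (suc n) (0 , 0 , suc b , c) = (true , false)  ∷ᵥ realise n (0 , 0 , b , c)
  realise (suc n) (0 , 0 , 0 , c)     = (false , true)  ∷ᵥ realise n (0 , 0 , 0 , pred c)

  profile-realise : ∀ n p → total p ≡ n → profile (realise n p) ≡ p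
  profile-realise zero    (0 , 0 , 0 , 0)     refl = refl
  profile-realise (suc n) (suc a , d , b , c) eq   =
    cong (add (false , false)) (profile-realise n _ (suc-injective eq))
  profile-realise (suc n) (0 , suc d , b , c) eq   =
    cong (add (true , true)) (profile-realise n _ (suc-injective eq))
  profile-realise (suc n) (0 , 0 , suc b , c) eq   =
    cong (add (true , false)) (profile-realise n _ (suc-injective eq))
  profile-realise (suc n) (0 , 0 , 0 , suc c) eq   =
    cong (add (false , true)) (profile-realise n _ (suc-injective eq))

  bit : Fin 2 → Column → Bool
  bit zero       = proj₁
  bit (suc zero) = proj₂

  degree : Fin 2 → Profile → ℕ
  degree zero       (a , d , b , c) = b + d
  degree (suc zero) (a , d , b , c) = c + d

  degree-add : ∀ x t p → degree x (add t p) ≡ δᵇ (bit x t) true + degree x p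
  degree-add zero       (false , false) (a , d , b , c) = refl
  degree-add zero       (true  , true)  (a , d , b , c) = +-suc b d
  degree-add zero       (true  , false) (a , d , b , c) = refl
  degree-add zero       (false , true)  (a , d , b , c) = refl
  degree-add (suc zero) (false , false) (a , d , b , c) = refl
  degree-add (suc zero) (true  , true)  (a , d , b , c) = +-suc c d
  degree-add (suc zero) (true  , false) (a , d , b , c) = refl
  degree-add (suc zero) (false , true)  (a , d , b , c) = refl

  count-bit : ∀ {n} x (f : Vector Column n) → countᵇ true (bit x ∘ f) ≡ degree x (profile f)
  count-bit {zero}  zero       f = refl
  count-bit {zero}  (suc zero) f = refl
  count-bit {suc n} x          f = begin
    δᵇ (bit x (head f)) true + countᵇ true (bit x ∘ tail f)
      ≡⟨ cong (δᵇ (bit x (head f)) true +_) (count-bit x (tail f)) ⟩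
    δᵇ (bit x (head f)) true + degree x (profile (tail f))
      ≡⟨ degree-add x (head f) _ ⟨
    degree x (add (head f) (profile (tail f)))
      ≡⟨ cong (degree x) (profile-∷ (head f) (tail f)) ⟨
    degree x (profile f)
      ∎
    where open ≡-Reasoning

  columns : ∀ {n} → BipGraph 2 n → Vector Column n
  columns G y = G zero y , G (suc zero) y

  inConnDomain⇔0<degree : ∀ {n} (G : BipGraph 2 n) x →
    InConnDomain G x ⇔ 0 < degree x (profile (columns G))
  inConnDomain⇔0<degree G x =
    subst (λ k → InConnDomain G x ⇔ 0 < k) (degree-count x) (⇔-sym (0<countᵇ⇔∃ true (G x)))
    where
    degree-count : ∀ x → countᵇ true (G x) ≡ degree x (profile (columns G))
    degree-count zero       = count-bit zero (columns G)
    degree-count (suc zero) = count-bit (suc zero) (columns G)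

  Balanced : Profile → Set
  Balanced p = 0 < degree zero p ⇔ 0 < degree (suc zero) p

  balanced⇔inConnDomain-agree : ∀ {n} (H : BipGraph 2 n) →
    Balanced (profile (columns H)) ⇔ (InConnDomain H zero ⇔ InConnDomain H (suc zero))
  balanced⇔inConnDomain-agree H =
    mk⇔ (λ balanced → ⇔-sym (domain (suc zero)) ⇔-∘ (balanced ⇔-∘ domain zero))
        (λ agree → domain (suc zero) ⇔-∘ (agree ⇔-∘ ⇔-sym (domain zero)))
    where domain = inConnDomain⇔0<degree H

  Related : Profile → Profile → Set
  Related p q = p ≡ q ⊎ (p ≡ swapᴾ q × Balanced q)

  permutation₂≈id⊎reverse : (π : Permutation′ 2) → π ≈ id ⊎ π ≈ reverse
  permutation₂≈id⊎reverse π
    with π ⟨$⟩ʳ zero in π0 | π ⟨$⟩ʳ suc zero in π1 | inverseˡ π {zero} | inverseˡ π {suc zero}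
  ... | zero     | suc zero | _    | _    = inj₁ λ { zero → π0 ; (suc zero) → π1 }
  ... | suc zero | zero     | _    | _    = inj₂ λ { zero → π0 ; (suc zero) → π1 }
  ... | zero     | zero     | π⁻¹0 | π⁻¹1 = contradiction (trans (sym π⁻¹0) π⁻¹1) λ ()
  ... | suc zero | suc zero | π⁻¹0 | π⁻¹1 = contradiction (trans (sym π⁻¹0) π⁻¹1) λ ()

  inConnDomain-relabel : ∀ {n} {G H : BipGraph 2 n} α (β : Permutation′ n) →
    (∀ x y → G x y ≡ H (α ⟨$⟩ʳ x) (β ⟨$⟩ʳ y)) →
    ∀ x → InConnDomain G x ⇔ InConnDomain H (α ⟨$⟩ʳ x)
  inConnDomain-relabel {H = H} α β G≅H x =
    mk⇔ (λ (y , Gxy) → β ⟨$⟩ʳ y , trans (sym (G≅H x y)) Gxy)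
        (λ (y , Hxy) → β ⟨$⟩ˡ y , trans (G≅H x (β ⟨$⟩ˡ y)) (trans (cong (H _) (inverseʳ β)) Hxy))

  lslEquiv⇔related : ∀ {n} (G H : BipGraph 2 n) →
    LSLEquiv G H ⇔ Related (profile (columns G)) (profile (columns H))
  lslEquiv⇔related G H = mk⇔ related lslEquiv
    where
    related : LSLEquiv G H → Related (profile (columns G)) (profile (columns H))
    related ((α , β , G≅H) , domain) with permutation₂≈id⊎reverse α
    ... | inj₁ α≈id =
      inj₁ (from (profile≡⇔rearrangement _ _) (β , λ y → cong₂ _,_ (edge zero y) (edge (suc zero) y)))
      where
      edge : ∀ x y → G x y ≡ H x (β ⟨$⟩ʳ y)
      edge x y = trans (G≅H x y) (cong (λ z → H z _) (α≈id x))
    ... | inj₂ α≈rev =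
      inj₂ (swapped , from (balanced⇔inConnDomain-agree H)
                           (inConnDomain-relabel {H = H} reverse β edge zero ⇔-∘ ⇔-sym (domain zero)))
      where
      edge : ∀ x y → G x y ≡ H (reverse ⟨$⟩ʳ x) (β ⟨$⟩ʳ y)
      edge x y = trans (G≅H x y) (cong (λ z → H z _) (α≈rev x))
      swapped : profile (columns G) ≡ swapᴾ (profile (columns H))
      swapped = trans (from (profile≡⇔rearrangement _ (swap ∘ columns H))
                            (β , λ y → cong₂ _,_ (edge zero y) (edge (suc zero) y)))
                      (profile-swap (columns H))

    lslEquiv : Related (profile (columns G)) (profile (columns H)) → LSLEquiv G H
    lslEquiv (inj₁ same) with to (profile≡⇔rearrangement (columns G) (columns H)) same
    ... | β , columns≅ = (id , β , edge) , inConnDomain-relabel id β edge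
      where
      edge : ∀ x y → G x y ≡ H (id ⟨$⟩ʳ x) (β ⟨$⟩ʳ y)
      edge zero       y = cong proj₁ (columns≅ y)
      edge (suc zero) y = cong proj₂ (columns≅ y)
    lslEquiv (inj₂ (swapped , balanced))
      with to (profile≡⇔rearrangement (columns G) (swap ∘ columns H))
              (trans swapped (sym (profile-swap (columns H))))
    ... | β , columns≅ =
      (reverse , β , edge) , λ x → unreversed x ⇔-∘ inConnDomain-relabel {H = H} reverse β edge x
      where
      edge : ∀ x y → G x y ≡ H (reverse ⟨$⟩ʳ x) (β ⟨$⟩ʳ y)
      edge zero       y = cong proj₁ (columns≅ y)
      edge (suc zero) y = cong proj₂ (columns≅ y)
      unreversed : ∀ x → InConnDomain H (reverse ⟨$⟩ʳ x) ⇔ InConnDomain H x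
      unreversed zero       = ⇔-sym (to (balanced⇔inConnDomain-agree H) balanced)
      unreversed (suc zero) = to (balanced⇔inConnDomain-agree H) balanced

  -- Among p and swapᴾ p prefer only₀ ≤ only₁; a profile (a , 0 , b , 0) is kept as it is,
  -- since swapping it would move the isolated left vertex and so is no equivalence.
  Canonical : Profile → Set
  Canonical (a , d , b , c) = b ≤ c ⊎ (c ≡ 0 × d ≡ 0)

  canonical? : Decidable Canonical
  canonical? (a , d , b , c) = b ≤? c ⊎-dec (c ≟ 0 ×-dec d ≟ 0)

  canon : Profile → Profile
  canon p with canonical? p
  ... | yes _ = p
  ... | no  _ = swapᴾ p

  canon-canonical : ∀ p → Canonical p → canon p ≡ p
  canon-canonical p can with canonical? p
  ... | yes _   = refl
  ... | no ¬can = contradiction can ¬can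

  canonical-canon : ∀ p → Canonical (canon p)
  canonical-canon (a , d , b , c) with canonical? (a , d , b , c)
  ... | yes can = can
  ... | no ¬can = inj₁ (≰⇒≥ (¬can ∘ inj₁))

  total-canon : ∀ p → total (canon p) ≡ total p
  total-canon (a , d , b , c) with canonical? (a , d , b , c)
  ... | yes _ = refl
  ... | no _  = cong (λ k → a + (d + k)) (+-comm c b)

  balanced-swap : ∀ p → ¬ Canonical p → Balanced (swapᴾ p)
  balanced-swap (a , d , b , c) ¬can = mk⇔ (λ _ → 0<b+d) (λ _ → 0<c+d c d (¬can ∘ inj₂))
    where
    0<b+d : 0 < b + d
    0<b+d = ≤-trans (≤-trans (s≤s z≤n) (≰⇒> (¬can ∘ inj₁))) (m≤m+n b d)
    0<c+d : ∀ c d → ¬ (c ≡ 0 × d ≡ 0) → 0 < c + d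
    0<c+d (suc c) d       _      = s≤s z≤n
    0<c+d zero    (suc d) _      = s≤s z≤n
    0<c+d zero    zero    ¬zeros = contradiction (refl , refl) ¬zeros

  related-canon : ∀ p → Related p (canon p)
  related-canon p with canonical? p
  ... | yes _   = inj₁ refl
  ... | no ¬can = inj₂ (refl , balanced-swap p ¬can)

  canonical-both-ways : ∀ {a d b c} → Balanced (a , d , b , c) →
    Canonical (a , d , b , c) → Canonical (a , d , c , b) → b ≡ c
  canonical-both-ways             _        (inj₁ b≤c)           (inj₁ c≤b)           = ≤-antisym b≤c c≤b
  canonical-both-ways {c = zero}  _        (inj₁ _)             (inj₂ (refl , refl)) = refl
  canonical-both-ways {c = suc _} balanced (inj₁ _)             (inj₂ (refl , refl)) =
    contradiction (from balanced (s≤s z≤n)) λ ()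
  canonical-both-ways {b = zero}  _        (inj₂ (refl , refl)) (inj₁ _)             = refl
  canonical-both-ways {b = suc _} balanced (inj₂ (refl , refl)) (inj₁ _)             =
    contradiction (to balanced (s≤s z≤n)) λ ()
  canonical-both-ways             _        (inj₂ (refl , refl)) (inj₂ (refl , _))    = refl

  canon-swap : ∀ p → Balanced p → canon (swapᴾ p) ≡ canon p
  canon-swap (a , d , b , c) balanced with canonical? (a , d , c , b) | canonical? (a , d , b , c)
  ... | yes can′ | yes can = cong₂ (λ x y → a , d , x , y) (sym b≡c) b≡c
    where b≡c = canonical-both-ways {a} {d} balanced can can′
  ... | yes _    | no _    = refl
  ... | no _     | yes _   = refl
  ... | no ¬can′ | no ¬can = contradiction (≰⇒≥ (¬can ∘ inj₁)) (¬can′ ∘ inj₁)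

  canon-related : ∀ {p q} → Related p q → canon p ≡ canon q
  canon-related         (inj₁ refl)              = refl
  canon-related {q = q} (inj₂ (refl , balanced)) = canon-swap q balanced

  invariant : ∀ {n} → BipGraph 2 n → Profile
  invariant G = canon (profile (columns G))

  representative : (n : ℕ) → Profile → BipGraph 2 n
  representative n p x y = bit x (realise n p y)

  invariant-respects-lslEquiv : ∀ {n} {G H : BipGraph 2 n} → LSLEquiv G H → invariant G ≡ invariant H
  invariant-respects-lslEquiv {G = G} {H} G∼H = canon-related (to (lslEquiv⇔related G H) G∼H)

  invariant-representative : ∀ n p → Canonical p → total p ≡ n → invariant (representative n p) ≡ p
  invariant-representative n p can total≡n =
    trans (cong canon (profile-realise n p total≡n)) (canon-canonical p can)

  lslEquiv-representative : ∀ {n} (G : BipGraph 2 n) → LSLEquiv G (representative n (invariant G))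
  lslEquiv-representative {n} G = from (lslEquiv⇔related G _)
    (subst (Related (profile (columns G))) (sym realised) (related-canon (profile (columns G))))
    where
    realised : profile (realise n (invariant G)) ≡ invariant G
    realised = profile-realise n _ (trans (total-canon (profile (columns G))) (total-profile (columns G)))

  module _ {A : Set} where

    spread : (ℕ → List A) → ℕ → List (ℕ × A)
    spread F zero    = map (0 ,′_) (F zero)
    spread F (suc n) = map (0 ,′_) (F (suc n)) ++ map (map₁ suc) (spread F n)

    ∈-spread : ∀ F n k (x : A) → (k , x) ∈ spread F n ⇔ ∃ λ m → k + m ≡ n × x ∈ F m
    ∈-spread F n k x = mk⇔ (split n)
      (λ (m , k+m≡n , x∈Fm) → subst (λ n → (k , x) ∈ spread F n) k+m≡n (spread⁺ k x∈Fm))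
      where
      split : ∀ n {k x} → (k , x) ∈ spread F n → ∃ λ m → k + m ≡ n × x ∈ F m
      split zero    k,x∈ with ∈-map⁻ (0 ,′_) k,x∈
      ... | _ , x∈F0 , refl = 0 , refl , x∈F0
      split (suc n) k,x∈ with ∈-++⁻ (map (0 ,′_) (F (suc n))) k,x∈
      ... | inj₁ k,x∈head with ∈-map⁻ (0 ,′_) k,x∈head
      ...   | _ , x∈F , refl = suc n , refl , x∈F
      split (suc n) k,x∈ | inj₂ k,x∈tail with ∈-map⁻ (map₁ suc) k,x∈tail
      ...   | _ , k′,x∈ , refl =
        let (m , k′+m≡n , x∈Fm) = split n k′,x∈ in m , cong suc k′+m≡n , x∈Fm
      spread⁺ : ∀ k {m x} → x ∈ F m → (k , x) ∈ spread F (k + m)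
      spread⁺ zero    {zero}  x∈F = ∈-map⁺ (0 ,′_) x∈F
      spread⁺ zero    {suc m} x∈F = ∈-++⁺ˡ (∈-map⁺ (0 ,′_) x∈F)
      spread⁺ (suc k)         x∈F = ∈-++⁺ʳ _ (∈-map⁺ (map₁ suc) (spread⁺ k x∈F))

    spread-unique : ∀ F → (∀ m → Unique (F m)) → ∀ n → Unique (spread F n)
    spread-unique F unique zero    = Unique.map⁺ (cong proj₂) (unique zero)
    spread-unique F unique (suc n) =
      Unique.++⁺ (Unique.map⁺ (cong proj₂) (unique (suc n)))
                 (Unique.map⁺ (λ eq → cong₂ _,_ (suc-injective (cong proj₁ eq)) (cong proj₂ eq))
                              (spread-unique F unique n))
                 disjoint
      where
      disjoint : Disjoint (map (0 ,′_) (F (suc n))) (map (map₁ suc) (spread F n))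
      disjoint (v∈head , v∈tail) with ∈-map⁻ (0 ,′_) v∈head | ∈-map⁻ (map₁ suc) v∈tail
      ... | _ , _ , refl | _ , _ , ()

  sortedSplits : ℕ → List (ℕ × ℕ)
  sortedSplits zero          = (0 , 0) ∷ []
  sortedSplits (suc zero)    = (0 , 1) ∷ []
  sortedSplits (suc (suc n)) = (0 , suc (suc n)) ∷ map (Product.map suc suc) (sortedSplits n)

  ∈-sortedSplits : ∀ n b c → (b , c) ∈ sortedSplits n ⇔ (b + c ≡ n × b ≤ c)
  ∈-sortedSplits n b c = mk⇔ (split n)
    (λ (b+c≡n , b≤c) → subst (λ n → (b , c) ∈ sortedSplits n) b+c≡n (sorted⁺ b c b≤c))
    where
    split : ∀ n {b c} → (b , c) ∈ sortedSplits n → b + c ≡ n × b ≤ c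
    split zero          (here refl) = refl , z≤n
    split (suc zero)    (here refl) = refl , z≤n
    split (suc (suc n)) (here refl) = refl , z≤n
    split (suc (suc n)) (there b,c∈) with ∈-map⁻ (Product.map suc suc) b,c∈
    ... | (b , c) , b,c∈′ , refl =
      let (b+c≡n , b≤c) = split n b,c∈′ in cong suc (trans (+-suc b c) (cong suc b+c≡n)) , s≤s b≤c
    sorted⁺ : ∀ b c → b ≤ c → (b , c) ∈ sortedSplits (b + c)
    sorted⁺ zero    zero          _         = here refl
    sorted⁺ zero    (suc zero)    _         = here refl
    sorted⁺ zero    (suc (suc c)) _         = here refl
    sorted⁺ (suc b) (suc c)       (s≤s b≤c) = subst (λ n → (suc b , suc c) ∈ sortedSplits n)
      (cong suc (sym (+-suc b c))) (there (∈-map⁺ _ (sorted⁺ b c b≤c)))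

  sortedSplits-unique : ∀ n → Unique (sortedSplits n)
  sortedSplits-unique zero          = All.[] ∷ []
  sortedSplits-unique (suc zero)    = All.[] ∷ []
  sortedSplits-unique (suc (suc n)) =
    All.tabulate (λ x∈ → head≢ (∈-map⁻ (Product.map suc suc) x∈)) ∷ Unique.map⁺ injective (sortedSplits-unique n)
    where
    head≢ : ∀ {x} → ∃ (λ y → y ∈ sortedSplits n × x ≡ Product.map suc suc y) → (0 , suc (suc n)) ≢ x
    head≢ (_ , _ , refl) ()
    injective : ∀ {x y} → Product.map suc suc x ≡ Product.map suc suc y → x ≡ y
    injective eq = cong₂ _,_ (suc-injective (cong proj₁ eq)) (suc-injective (cong proj₂ eq))

  lopsided : ℕ → List (ℕ × ℕ × ℕ)
  lopsided zero    = []
  lopsided (suc m) = (0 , suc m , 0) ∷ []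

  canonicalWithoutIsolated : ℕ → List (ℕ × ℕ × ℕ)
  canonicalWithoutIsolated m = spread sortedSplits m ++ lopsided m

  canonicalProfiles : ℕ → List Profile
  canonicalProfiles = spread canonicalWithoutIsolated

  ∈-canonicalProfiles : ∀ n p → p ∈ canonicalProfiles n ⇔ (Canonical p × total p ≡ n)
  ∈-canonicalProfiles n p = mk⇔ (sound p) (λ (can , total≡n) → complete p can total≡n)
    where
    sound : ∀ p → p ∈ canonicalProfiles n → Canonical p × total p ≡ n
    sound (a , rest) p∈ with to (∈-spread _ n a rest) p∈
    ... | m , a+m≡n , rest∈ with ∈-++⁻ (spread sortedSplits m) rest∈
    ...   | inj₁ rest∈spread =
      let (d , b , c) = rest
          (m′ , d+m′≡m , b,c∈) = to (∈-spread sortedSplits m d (b , c)) rest∈spread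
          (b+c≡m′ , b≤c) = to (∈-sortedSplits m′ b c) b,c∈
      in inj₁ b≤c , trans (cong (λ k → a + (d + k)) b+c≡m′) (trans (cong (a +_) d+m′≡m) a+m≡n)
    ...   | inj₂ rest∈lopsided = lopsided-sound m rest∈lopsided a+m≡n
      where
      lopsided-sound : ∀ m {rest} → rest ∈ lopsided m → a + m ≡ n →
                       Canonical (a , rest) × total (a , rest) ≡ n
      lopsided-sound (suc m) (here refl) a+m≡n =
        inj₂ (refl , refl) , trans (cong (λ k → a + suc k) (+-identityʳ m)) a+m≡n
    complete : ∀ p → Canonical p → total p ≡ n → p ∈ canonicalProfiles n
    complete (a , d , b , c) (inj₁ b≤c) total≡n = from (∈-spread _ n a _) (_ , total≡n ,
      ∈-++⁺ˡ (from (∈-spread sortedSplits _ d _) (_ , refl , from (∈-sortedSplits _ b c) (refl , b≤c))))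
    complete (a , d , zero , c) (inj₂ (refl , refl)) total≡n = complete _ (inj₁ z≤n) total≡n
    complete (a , d , suc b , c) (inj₂ (refl , refl)) total≡n = from (∈-spread _ n a _) (suc (b + 0) , total≡n ,
      ∈-++⁺ʳ (spread sortedSplits (suc (b + 0))) (here (cong (λ k → 0 , suc k , 0) (sym (+-identityʳ b)))))

  canonicalProfiles-unique : ∀ n → Unique (canonicalProfiles n)
  canonicalProfiles-unique = spread-unique _ λ m →
    Unique.++⁺ (spread-unique sortedSplits sortedSplits-unique m) (lopsided-unique m) (disjoint m)
    where
    lopsided-unique : ∀ m → Unique (lopsided m)
    lopsided-unique zero    = []
    lopsided-unique (suc m) = All.[] ∷ []
    disjoint : ∀ m → Disjoint (spread sortedSplits m) (lopsided m)
    disjoint (suc m) (x∈spread , here refl) with to (∈-spread sortedSplits (suc m) 0 (suc m , 0)) x∈spread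
    ... | m′ , _ , b,c∈ with to (∈-sortedSplits m′ (suc m) 0) b,c∈
    ...   | _ , ()

  classRepresentatives : (n : ℕ) → List (BipGraph 2 n)
  classRepresentatives n = map (representative n) (canonicalProfiles n)

  classRepresentatives-complete : ∀ {n} (G : BipGraph 2 n) → Any (LSLEquiv G) (classRepresentatives n)
  classRepresentatives-complete {n} G =
    Any.map⁺ (Any.map (λ { refl → lslEquiv-representative G }) invariant∈)
    where
    invariant∈ : invariant G ∈ canonicalProfiles n
    invariant∈ = from (∈-canonicalProfiles n (invariant G))
      (canonical-canon (profile (columns G)) , trans (total-canon (profile (columns G))) (total-profile (columns G)))

  classRepresentatives-distinct : ∀ n → AllPairs (λ G H → ¬ LSLEquiv G H) (classRepresentatives n)
  classRepresentatives-distinct n =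
    AllPairs.map (λ invariants≢ G∼H → invariants≢ (invariant-respects-lslEquiv G∼H))
                 (AllPairs.map⁻ (subst Unique (sym invariants) (canonicalProfiles-unique n)))
    where
    invariants : map invariant (classRepresentatives n) ≡ canonicalProfiles n
    invariants = trans (sym (map-∘ (canonicalProfiles n))) (map-id-local (All.tabulate λ {p} p∈ →
      let (can , total≡n) = to (∈-canonicalProfiles n p) p∈ in invariant-representative n p can total≡n))

module Cardinality where

  open Classification
  import Data.Nat as ℕ
  open import Data.Integer using (ℤ; +_; -1ℤ; 1ℤ; _+_; _*_; _^_)
  open import Data.Integer.Properties using (pos-+)
  open import Data.Integer.Tactic.RingSolver using (solve-∀)

  #_ : ∀ {A : Set} → List A → ℤ
  # xs = + length xs

  #-spread : ∀ {A : Set} (F : ℕ → List A) n → # spread F (suc n) ≡ # F (suc n) + # spread F n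
  #-spread F n = begin
    + length (map (0 ,′_) (F (suc n)) ++ map (map₁ suc) (spread F n))
      ≡⟨ cong +_ (length-++ (map (0 ,′_) (F (suc n)))) ⟩
    + (length (map (0 ,′_) (F (suc n))) ℕ.+ length (map (map₁ suc) (spread F n)))
      ≡⟨ cong₂ (λ k l → + (k ℕ.+ l)) (length-map _ (F (suc n))) (length-map _ (spread F n)) ⟩
    + (length (F (suc n)) ℕ.+ length (spread F n))
      ≡⟨ pos-+ (length (F (suc n))) _ ⟩
    # F (suc n) + # spread F n
      ∎
    where open ≡-Reasoning

  #-sortedSplits : ∀ n → + 4 * # sortedSplits n ≡ + 2 * + n + + 3 + -1ℤ ^ n
  #-sortedSplits zero          = refl
  #-sortedSplits (suc zero)    = refl
  #-sortedSplits (suc (suc n)) = begin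
    + 4 * + suc (length (map (Product.map suc suc) (sortedSplits n)))
      ≡⟨ cong (λ k → + 4 * + suc k) (length-map _ (sortedSplits n)) ⟩
    + 4 * (+ 1 + # sortedSplits n)
      ≡⟨ distrib (# sortedSplits n) ⟩
    + 4 + + 4 * # sortedSplits n
      ≡⟨ cong (λ x → + 4 + x) (#-sortedSplits n) ⟩
    + 4 + (+ 2 * + n + + 3 + -1ℤ ^ n)
      ≡⟨ rearrange (+ n) (-1ℤ ^ n) ⟩
    + 2 * (+ 2 + + n) + + 3 + -1ℤ * (-1ℤ * -1ℤ ^ n)
      ∎
    where
    open ≡-Reasoning
    distrib : ∀ L → + 4 * (+ 1 + L) ≡ + 4 + + 4 * L
    distrib = solve-∀
    rearrange : ∀ N s → + 4 + (+ 2 * N + + 3 + s) ≡ + 2 * (+ 2 + N) + + 3 + -1ℤ * (-1ℤ * s)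
    rearrange = solve-∀

  #-spread-sortedSplits : ∀ n →
    + 8 * # spread sortedSplits n ≡ + 2 * (+ n * + n) + + 8 * + n + + 7 + -1ℤ ^ n
  #-spread-sortedSplits zero    = refl
  #-spread-sortedSplits (suc n) = begin
    + 8 * # spread sortedSplits (suc n)
      ≡⟨ cong (+ 8 *_) (#-spread sortedSplits n) ⟩
    + 8 * (# sortedSplits (suc n) + # spread sortedSplits n)
      ≡⟨ distrib (# sortedSplits (suc n)) _ ⟩
    + 2 * (+ 4 * # sortedSplits (suc n)) + + 8 * # spread sortedSplits n
      ≡⟨ cong₂ (λ x y → + 2 * x + y) (#-sortedSplits (suc n)) (#-spread-sortedSplits n) ⟩
    + 2 * (+ 2 * (+ 1 + + n) + + 3 + -1ℤ * s) + (+ 2 * (+ n * + n) + + 8 * + n + + 7 + s)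
      ≡⟨ rearrange (+ n) s ⟩
    + 2 * ((+ 1 + + n) * (+ 1 + + n)) + + 8 * (+ 1 + + n) + + 7 + -1ℤ * s
      ∎
    where
    open ≡-Reasoning
    s = -1ℤ ^ n
    distrib : ∀ H S → + 8 * (H + S) ≡ + 2 * (+ 4 * H) + + 8 * S
    distrib = solve-∀
    rearrange : ∀ N s → + 2 * (+ 2 * (+ 1 + N) + + 3 + -1ℤ * s) + (+ 2 * (N * N) + + 8 * N + + 7 + s)
                      ≡ + 2 * ((+ 1 + N) * (+ 1 + N)) + + 8 * (+ 1 + N) + + 7 + -1ℤ * s
    rearrange = solve-∀

  #-canonicalProfiles : ∀ r → + 48 * # canonicalProfiles r
    ≡ + 4 * ((+ r) ^ 3) + + 30 * ((+ r) ^ 2) + + 116 * + r + + 45 + + 3 * (-1ℤ ^ r)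
  #-canonicalProfiles zero    = refl
  #-canonicalProfiles (suc r) = begin
    + 48 * # canonicalProfiles (suc r)
      ≡⟨ cong (+ 48 *_) (#-spread canonicalWithoutIsolated r) ⟩
    + 48 * (# (spread sortedSplits (suc r) ++ lopsided (suc r)) + # canonicalProfiles r)
      ≡⟨ cong (λ k → + 48 * (+ k + # canonicalProfiles r)) (length-++ (spread sortedSplits (suc r))) ⟩
    + 48 * (# spread sortedSplits (suc r) + + 1 + # canonicalProfiles r)
      ≡⟨ distrib (# spread sortedSplits (suc r)) _ ⟩
    + 6 * (+ 8 * # spread sortedSplits (suc r)) + + 48 + + 48 * # canonicalProfiles r
      ≡⟨ cong₂ (λ x y → + 6 * x + + 48 + y) (#-spread-sortedSplits (suc r)) (#-canonicalProfiles r) ⟩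
    + 6 * (+ 2 * ((+ 1 + R) * (+ 1 + R)) + + 8 * (+ 1 + R) + + 7 + -1ℤ * s) + + 48
      + (+ 4 * (R * (R * (R * 1ℤ))) + + 30 * (R * (R * 1ℤ)) + + 116 * R + + 45 + + 3 * s)
      ≡⟨ rearrange R s ⟩
    + 4 * ((+ 1 + R) * ((+ 1 + R) * ((+ 1 + R) * 1ℤ))) + + 30 * ((+ 1 + R) * ((+ 1 + R) * 1ℤ))
      + + 116 * (+ 1 + R) + + 45 + + 3 * (-1ℤ * s)
      ∎
    where
    open ≡-Reasoning
    R = + r
    s = -1ℤ ^ r
    distrib : ∀ S C → + 48 * (S + + 1 + C) ≡ + 6 * (+ 8 * S) + + 48 + + 48 * C
    distrib = solve-∀
    -- Powers written as the products (+ r) ^ k unfolds to, since solve-∀ does not read ℤ's _^_.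
    rearrange : ∀ R s →
      + 6 * (+ 2 * ((+ 1 + R) * (+ 1 + R)) + + 8 * (+ 1 + R) + + 7 + -1ℤ * s) + + 48
        + (+ 4 * (R * (R * (R * 1ℤ))) + + 30 * (R * (R * 1ℤ)) + + 116 * R + + 45 + + 3 * s)
      ≡ + 4 * ((+ 1 + R) * ((+ 1 + R) * ((+ 1 + R) * 1ℤ))) + + 30 * ((+ 1 + R) * ((+ 1 + R) * 1ℤ))
        + + 116 * (+ 1 + R) + + 45 + + 3 * (-1ℤ * s)
    rearrange = solve-∀

open Classification
  using (representative; canonicalProfiles; classRepresentatives
        ; classRepresentatives-complete; classRepresentatives-distinct)
open Cardinality using (#-canonicalProfiles)
open import Data.Integer using (+_; -_; _+_; _*_; _^_)

-- The count also holds for r = 0 (one class, the empty graph).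
mainTheorem1 : (r : ℕ) → 1 ≤ r →
    Σ ℕ λ N → NumClassesIs 2 r N
    × (+ 48 * + N ≡ + 4 * ((+ r) ^ 3) + + 30 * ((+ r) ^ 2) + + 116 * + r + + 45 + + 3 * ((- (+ 1)) ^ r))
mainTheorem1 r _ =
  length (classRepresentatives r) ,
  (classRepresentatives r , refl , classRepresentatives-complete , classRepresentatives-distinct r) ,
  trans (cong (λ k → + 48 * + k) (length-map (representative r) (canonicalProfiles r))) (#-canonicalProfiles r)
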